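{- There exists a constant $c > 0$ such that for all integers $n \geq 1$, $m \geq 0$, $k$ with $D_{n,m,k} > 0$, we have $\log_2(D_{n,m,k}) \leq c \cdot m \cdot \log_2 n$.
   Context: A directed ordered acyclic graph (DOAG) is a tuple $(V, E, (\prec_v)_{v \in V \cup \{\emptyset\}})$ where $V$ is a finite set of vertices, $E \subseteq V \times V$ is a set of edges such that the directed graph $(V,E)$ is acyclic, for each $v \in V$, $\prec_v$ is a total order on the set of outgoing edges of $v$, and $\prec_\emptyset$ is a total order on the set of sources (vertices with no incoming edge). Two DOAGs are considered equal if there is a bijection between their vertex sets preserving the edges and all the orders. $D_{n,m,k}$ denotes the number of DOAGs with $n$ vertices, $m$ edges and $k$ sources. -}

module Defs where

open import Data.Nat using (ℕ)
open import Data.Fin using (Fin)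
open import Data.List using (List; length; map; allFin)
open import Data.Nat.ListAction using (sum)
open import Data.List.Membership.Propositional using (_∈_)
open import Data.List.Relation.Unary.Unique.Propositional using (Unique)
open import Data.List.Relation.Unary.All using (All)
open import Data.List.Relation.Unary.Any using (Any)
open import Data.List.Relation.Unary.AllPairs using (AllPairs)
open import Data.Product using (Σ; _×_)
open import Function.Bundles using (_↔_; Inverse)
open import Relation.Binary.Construct.Closure.Transitive using (TransClosure)
open import Relation.Binary.PropositionalEquality using (_≡_)
open import Relation.Nullary using (¬_)

-- A DOAG whose vertex set is (a labelling by) Fin n.
--  * out v   : the outgoing edges of v, listed in the order ≺_v
--              (edge (v , w) is represented by w ∈ out v; no duplicates)
--  * srcs    : the sources, listed in the order ≺_∅
record DOAG (n : ℕ) : Set where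
  field
    out         : Fin n → List (Fin n)
    srcs        : List (Fin n)
    out-unique  : ∀ v → Unique (out v)
    srcs-unique : Unique srcs
    srcs-sound  : ∀ v → v ∈ srcs → ∀ u → ¬ (v ∈ out u)
    srcs-compl  : ∀ v → (∀ u → ¬ (v ∈ out u)) → v ∈ srcs
    acyclic     : ∀ v → ¬ TransClosure (λ u w → w ∈ out u) v v

open DOAG public

edges : ∀ {n} → DOAG n → ℕ
edges {n} g = sum (map (λ v → length (out g v)) (allFin n))

sources : ∀ {n} → DOAG n → ℕ
sources g = length (srcs g)

-- Equality of DOAGs: a bijection of vertices preserving edges and all orders.
Iso : ∀ {n} → DOAG n → DOAG n → Set
Iso {n} g h = Σ (Fin n ↔ Fin n) λ σ →
  (∀ v → map (Inverse.to σ) (out g v) ≡ out h (Inverse.to σ v))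
  × map (Inverse.to σ) (srcs g) ≡ srcs h

-- D n m k D : the number D_{n,m,k} of DOAGs (up to equality/isomorphism) with
-- n vertices, m edges and k sources equals D, i.e. there is a list of D
-- pairwise non-isomorphic such DOAGs containing a representative of every one.
IsD : ℕ → ℕ → ℕ → ℕ → Set
IsD n m k D = Σ (List (DOAG n)) λ L →
    length L ≡ D
  × All (λ g → edges g ≡ m × sources g ≡ k) L
  × AllPairs (λ g h → ¬ Iso g h) L
  × (∀ (g : DOAG n) → edges g ≡ m → sources g ≡ k → Any (Iso g) L)

-- Relabel every DOAG by a permutation sending its ordered list of sources to a fixed
-- list that depends only on the number k of sources.  Two DOAGs with k sources whose
-- relabelled adjacency lists agree are then isomorphic, and a relabelled DOAG with m
-- edges is determined by its list of m arcs (u , w), each one of n² pairs.  Hence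
-- D_{n,m,k} ≤ (n²)^m = n^(2m).

module Submission where

open import Defs
open import Data.Empty using (⊥-elim)
open import Data.Fin as F using (Fin; zero; suc; toℕ; combine)
open import Data.Fin.Permutation
  using (Permutation′; _⟨$⟩ʳ_; _⟨$⟩ˡ_; inverseˡ; inverseʳ; transpose; _∘ₚ_; flip; id)
open import Data.Fin.Properties
  using (_≟_; toℕ-fromℕ<; toℕ-injective; toℕ<n; combine-injective; pigeonhole)
open import Data.List
  using (List; []; _∷_; _++_; map; length; lookup; allFin; downFrom; filter; concatMap)
open import Data.List.Membership.Propositional using (_∈_; _∉_)
open import Data.List.Membership.Propositional.Properties
  using (∈-map⁺; ∈-map⁻; ∈-lookup; ∈-allFin; ∈-downFrom⁺; ∈-downFrom⁻)
open import Data.List.Properties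
  using ( map-∘; map-id; map-id-local; map-cong; map-++; map-injective; ++-identityʳ
        ; length-map; length-++; filter-++; filter-all; filter-none)
open import Data.List.Relation.Unary.All as All using (All; []; _∷_)
import Data.List.Relation.Unary.All.Properties as All
open import Data.List.Relation.Unary.AllPairs using (AllPairs; []; _∷_)
open import Data.List.Relation.Unary.Any using (here; there)
open import Data.List.Relation.Unary.Unique.Propositional using (Unique)
import Data.List.Relation.Unary.Unique.Propositional.Properties as Unique
open import Data.List.Relation.Unary.Unique.Propositional.Properties using (allFin⁺)
open import Data.Nat using (ℕ; zero; suc; _+_; _*_; _^_; _≤_; _<_; z≤n; s≤s; NonZero; s<s⁻¹)
open import Data.Nat.DivMod using (_mod_; m<n⇒m%n≡m)
open import Data.Nat.ListAction using (sum)
open import Data.Nat.Properties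
  using (_≤?_; _<?_; ≰⇒>; ≮⇒≥; <-irrefl; ≤-trans; <-trans; ^-*-assoc; *-identityʳ; suc-injective)
open import Data.Product using (Σ; _×_; _,_; proj₁; proj₂; uncurry)
open import Function using (_∘_)
open import Function.Bundles using (Injection)
open import Function.Properties.Inverse using (↔⇒↣)
open import Relation.Binary.Definitions using (DecidableEquality)
open import Relation.Binary.PropositionalEquality
open import Relation.Nullary using (¬_; Dec; yes; no)

module _ {A : Set} where

  AllPairs-lookup : ∀ {R : A → A → Set} {xs} → AllPairs R xs →
                    ∀ {i j : Fin (length xs)} → i F.< j → R (lookup xs i) (lookup xs j)
  AllPairs-lookup (Rx ∷ _)   {zero}  {suc j} _   = All.lookup Rx (∈-lookup j)
  AllPairs-lookup (_  ∷ Rxs) {suc i} {suc j} i<j = AllPairs-lookup Rxs (s<s⁻¹ i<j)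

  AllPairs-mapWithAll : ∀ {P : A → Set} {R S : A → A → Set} →
                        (∀ {x y} → P x → P y → R x y → S x y) →
                        ∀ {xs} → All P xs → AllPairs R xs → AllPairs S xs
  AllPairs-mapWithAll f []         []         = []
  AllPairs-mapWithAll f (px ∷ pxs) (Rx ∷ Rxs) =
    All.zipWith (λ (py , r) → f px py r) (pxs , Rx) ∷ AllPairs-mapWithAll f pxs Rxs

  distinct-images⇒length≤ : ∀ {M} (f : A → Fin M) {xs} →
                            AllPairs (λ x y → f x ≢ f y) xs → length xs ≤ M
  distinct-images⇒length≤ {M} f {xs} distinct with length xs ≤? M
  ... | yes ≤M = ≤M
  ... | no ≰M with i , j , i<j , same ← pigeonhole (≰⇒> ≰M) (f ∘ lookup xs)
    = ⊥-elim (AllPairs-lookup distinct i<j same)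

-- Lists shorter than m are padded with zero; only lists of length m are encoded faithfully.
encode : ∀ {M} m → List (Fin (suc M)) → Fin (suc M ^ m)
encode     zero    _        = zero
encode {M} (suc m) []       = combine {suc M} zero (encode m [])
encode {M} (suc m) (x ∷ xs) = combine {suc M} x (encode m xs)

encode-injective : ∀ {M} m {xs ys : List (Fin (suc M))} →
                   length xs ≡ m → length ys ≡ m → encode m xs ≡ encode m ys → xs ≡ ys
encode-injective zero    {[]}     {[]}     _     _     _  = refl
encode-injective (suc m) {x ∷ xs} {y ∷ ys} ∣xs∣≡ ∣ys∣≡ eq
  with x≡y , rest ← combine-injective x (encode m xs) y (encode m ys) eq
  = cong₂ _∷_ x≡y (encode-injective m (suc-injective ∣xs∣≡) (suc-injective ∣ys∣≡) rest)

module Arcs {A : Set} (_≟ᴬ_ : DecidableEquality A) {B : Set} where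

  arcs : (A → List B) → List A → List (A × B)
  arcs F = concatMap (λ u → map (u ,_) (F u))

  from? : ∀ u (e : A × B) → Dec (proj₁ e ≡ u)
  from? u e = proj₁ e ≟ᴬ u

  successors : A → List (A × B) → List B
  successors u = map proj₂ ∘ filter (from? u)

  successors-++ : ∀ u es fs → successors u (es ++ fs) ≡ successors u es ++ successors u fs
  successors-++ u es fs = trans (cong (map proj₂) (filter-++ (from? u) es fs))
                                (map-++ proj₂ (filter (from? u) es) (filter (from? u) fs))

  successors-from : ∀ u ws → successors u (map (u ,_) ws) ≡ ws
  successors-from u ws = begin
    successors u (map (u ,_) ws) ≡⟨ cong (map proj₂) (filter-all (from? u) from-u) ⟩
    map proj₂ (map (u ,_) ws)    ≡⟨ map-∘ ws ⟨
    map (λ w → w) ws             ≡⟨ map-id ws ⟩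
    ws                           ∎
    where
      open ≡-Reasoning
      from-u = All.map⁺ (All.universal (λ _ → refl) ws)

  successors-not-from : ∀ {u v} ws → v ≢ u → successors u (map (v ,_) ws) ≡ []
  successors-not-from {u} ws v≢u =
    cong (map proj₂) (filter-none (from? u) (All.map⁺ (All.universal (λ _ → v≢u) ws)))

  successors-arcs-∉ : ∀ F {u us} → u ∉ us → successors u (arcs F us) ≡ []
  successors-arcs-∉ F {u} {[]}     _  = refl
  successors-arcs-∉ F {u} {v ∷ us} u∉ = begin
    successors u (map (v ,_) (F v) ++ arcs F us)
      ≡⟨ successors-++ u (map (v ,_) (F v)) (arcs F us) ⟩
    successors u (map (v ,_) (F v)) ++ successors u (arcs F us)
      ≡⟨ cong₂ _++_ (successors-not-from (F v) (u∉ ∘ here ∘ sym)) (successors-arcs-∉ F (u∉ ∘ there)) ⟩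
    []
      ∎
    where open ≡-Reasoning

  successors-arcs : ∀ F {u us} → Unique us → u ∈ us → successors u (arcs F us) ≡ F u
  successors-arcs F {u} {u ∷ us} (u∉us ∷ _) (here refl) = begin
    successors u (map (u ,_) (F u) ++ arcs F us)
      ≡⟨ successors-++ u (map (u ,_) (F u)) (arcs F us) ⟩
    successors u (map (u ,_) (F u)) ++ successors u (arcs F us)
      ≡⟨ cong₂ _++_ (successors-from u (F u)) (successors-arcs-∉ F (λ u∈ → All.lookup u∉us u∈ refl)) ⟩
    F u ++ []
      ≡⟨ ++-identityʳ (F u) ⟩
    F u
      ∎
    where open ≡-Reasoning
  successors-arcs F {u} {v ∷ us} (v∉us ∷ us!) (there u∈us) = begin
    successors u (map (v ,_) (F v) ++ arcs F us)
      ≡⟨ successors-++ u (map (v ,_) (F v)) (arcs F us) ⟩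
    successors u (map (v ,_) (F v)) ++ successors u (arcs F us)
      ≡⟨ cong₂ _++_ (successors-not-from (F v) (All.lookup v∉us u∈us)) (successors-arcs F us! u∈us) ⟩
    F u
      ∎
    where open ≡-Reasoning

  length-arcs : ∀ F us → length (arcs F us) ≡ sum (map (length ∘ F) us)
  length-arcs F []       = refl
  length-arcs F (u ∷ us) =
    trans (length-++ (map (u ,_) (F u))) (cong₂ _+_ (length-map _ (F u)) (length-arcs F us))

module _ {n : ℕ} where

  transpose-matchˡ : ∀ (i j : Fin n) → transpose i j ⟨$⟩ʳ i ≡ j
  transpose-matchˡ i j with i ≟ i
  ... | yes _   = refl
  ... | no  i≢i = ⊥-elim (i≢i refl)

  transpose-noMatch : ∀ {i j k : Fin n} → k ≢ i → k ≢ j → transpose i j ⟨$⟩ʳ k ≡ k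
  transpose-noMatch {i} {j} {k} k≢i k≢j with k ≟ i
  ... | yes k≡i = ⊥-elim (k≢i k≡i)
  ... | no  _   with k ≟ j
  ...   | yes k≡j = ⊥-elim (k≢j k≡j)
  ...   | no  _   = refl

  ⟨$⟩ʳ-injective : ∀ (σ : Permutation′ n) {x y} → σ ⟨$⟩ʳ x ≡ σ ⟨$⟩ʳ y → x ≡ y
  ⟨$⟩ʳ-injective σ = Injection.injective (↔⇒↣ σ)

  Unique-map-⟨$⟩ʳ-allFin : ∀ (π : Permutation′ n) → Unique (map (π ⟨$⟩ʳ_) (allFin n))
  Unique-map-⟨$⟩ʳ-allFin π = Unique.map⁺ (⟨$⟩ʳ-injective π) (allFin⁺ n)

  ∈-map-⟨$⟩ʳ-allFin : ∀ (π : Permutation′ n) v → v ∈ map (π ⟨$⟩ʳ_) (allFin n)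
  ∈-map-⟨$⟩ʳ-allFin π v =
    subst (_∈ _) (inverseʳ π) (∈-map⁺ (π ⟨$⟩ʳ_) (∈-allFin (π ⟨$⟩ˡ v)))

module _ {n : ℕ} .{{_ : NonZero n}} where

  -- The labels j-1, …, 1, 0 read modulo n; repetitions only occur once j > n.
  canonical : ℕ → List (Fin n)
  canonical j = map (_mod n) (downFrom j)

  toℕ-mod : ∀ {j} → j < n → toℕ (j mod n) ≡ j
  toℕ-mod j<n = trans (toℕ-fromℕ< _) (m<n⇒m%n≡m j<n)

  canonical-complete : ∀ {j} → n ≤ j → (v : Fin n) → v ∈ canonical j
  canonical-complete n≤j v = subst (_∈ canonical _) (toℕ-injective (toℕ-mod (toℕ<n v)))
    (∈-map⁺ (_mod n) (∈-downFrom⁺ (≤-trans (toℕ<n v) n≤j)))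

  mod∉canonical : ∀ {j} → j < n → j mod n ∉ canonical j
  mod∉canonical {j} j<n j∈ with i , i∈ , j≡i ← ∈-map⁻ (_mod n) j∈ =
    <-irrefl i≡j i<j
    where
      i<j = ∈-downFrom⁻ i∈
      i≡j : i ≡ j
      i≡j = trans (sym (toℕ-mod (<-trans i<j j<n))) (trans (cong toℕ (sym j≡i)) (toℕ-mod j<n))

  canonicalise : (s : List (Fin n)) → Unique s →
                 Σ (Permutation′ n) λ σ → map (σ ⟨$⟩ʳ_) s ≡ canonical (length s)
  canonicalise []      _             = id , refl
  canonicalise (x ∷ s) (x∉s ∷ s!) with σ , σs≡ ← canonicalise s s! =
    σ ∘ₚ transpose y a , cong₂ _∷_ (transpose-matchˡ y a) (begin
      map ((transpose y a ⟨$⟩ʳ_) ∘ (σ ⟨$⟩ʳ_)) s      ≡⟨ map-∘ s ⟩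
      map (transpose y a ⟨$⟩ʳ_) (map (σ ⟨$⟩ʳ_) s)   ≡⟨ cong (map (transpose y a ⟨$⟩ʳ_)) σs≡ ⟩
      map (transpose y a ⟨$⟩ʳ_) (canonical j)        ≡⟨ map-id-local (All.tabulate fixed) ⟩
      canonical j                                    ∎)
    where
      open ≡-Reasoning
      j = length s
      y = σ ⟨$⟩ʳ x
      a = j mod n
      y∉ : y ∉ canonical j
      y∉ y∈ with z , z∈s , y≡σz ← ∈-map⁻ (σ ⟨$⟩ʳ_) (subst (y ∈_) (sym σs≡) y∈) =
        All.lookup x∉s z∈s (⟨$⟩ʳ-injective σ y≡σz)
      a∉ : a ∉ canonical j
      a∉ with j <? n
      ... | yes j<n = mod∉canonical j<n
      -- x ∷ s has no duplicates, so it cannot be longer than n.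
      ... | no  j≮n = ⊥-elim (y∉ (canonical-complete (≮⇒≥ j≮n) y))
      fixed : ∀ {c} → c ∈ canonical j → transpose y a ⟨$⟩ʳ c ≡ c
      fixed c∈ = transpose-noMatch (λ { refl → y∉ c∈ }) (λ { refl → a∉ c∈ })

module _ {n : ℕ} where

  relabel : Permutation′ n → (Fin n → List (Fin n)) → Fin n → List (Fin n)
  relabel σ F v = map (σ ⟨$⟩ʳ_) (F (σ ⟨$⟩ˡ v))

  map-inverseˡ : ∀ (σ : Permutation′ n) xs → map (σ ⟨$⟩ˡ_) (map (σ ⟨$⟩ʳ_) xs) ≡ xs
  map-inverseˡ σ xs =
    trans (sym (map-∘ xs)) (map-id-local (All.universal (λ _ → inverseˡ σ) xs))

  Iso-from-relabel : ∀ (g h : DOAG n) (σ ρ : Permutation′ n) →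
                     (∀ v → relabel σ (out g) v ≡ relabel ρ (out h) v) →
                     map (σ ⟨$⟩ʳ_) (srcs g) ≡ map (ρ ⟨$⟩ʳ_) (srcs h) →
                     Iso g h
  Iso-from-relabel g h σ ρ same-out same-srcs = σ ∘ₚ flip ρ , out-preserved , srcs-preserved
    where
      open ≡-Reasoning
      τ : Fin n → Fin n
      τ v = ρ ⟨$⟩ˡ (σ ⟨$⟩ʳ v)
      out-preserved : ∀ v → map τ (out g v) ≡ out h (τ v)
      out-preserved v = begin
        map τ (out g v)
          ≡⟨ map-∘ (out g v) ⟩
        map (ρ ⟨$⟩ˡ_) (map (σ ⟨$⟩ʳ_) (out g v))
          ≡⟨ cong (map (ρ ⟨$⟩ˡ_) ∘ map (σ ⟨$⟩ʳ_) ∘ out g) (inverseˡ σ) ⟨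
        map (ρ ⟨$⟩ˡ_) (relabel σ (out g) (σ ⟨$⟩ʳ v))
          ≡⟨ cong (map (ρ ⟨$⟩ˡ_)) (same-out (σ ⟨$⟩ʳ v)) ⟩
        map (ρ ⟨$⟩ˡ_) (relabel ρ (out h) (σ ⟨$⟩ʳ v))
          ≡⟨ map-inverseˡ ρ (out h (τ v)) ⟩
        out h (τ v)
          ∎
      srcs-preserved : map τ (srcs g) ≡ srcs h
      srcs-preserved = begin
        map τ (srcs g)                          ≡⟨ map-∘ (srcs g) ⟩
        map (ρ ⟨$⟩ˡ_) (map (σ ⟨$⟩ʳ_) (srcs g))  ≡⟨ cong (map (ρ ⟨$⟩ˡ_)) same-srcs ⟩
        map (ρ ⟨$⟩ˡ_) (map (ρ ⟨$⟩ʳ_) (srcs h))  ≡⟨ map-inverseˡ ρ (srcs h) ⟩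
        srcs h                                  ∎

module _ {n : ℕ} .{{_ : NonZero n}} where

  open Arcs (_≟_ {n})

  canonicalLabelling : DOAG n → Permutation′ n
  canonicalLabelling g = proj₁ (canonicalise (srcs g) (srcs-unique g))

  arcCode : DOAG n → List (Fin n × Fin n)
  arcCode g = arcs (relabel σ (out g)) (map (σ ⟨$⟩ʳ_) (allFin n))
    where σ = canonicalLabelling g

  length-arcCode : ∀ g → length (arcCode g) ≡ edges g
  length-arcCode g = begin
    length (arcs F (map (σ ⟨$⟩ʳ_) (allFin n)))         ≡⟨ length-arcs F (map (σ ⟨$⟩ʳ_) (allFin n)) ⟩
    sum (map (length ∘ F) (map (σ ⟨$⟩ʳ_) (allFin n)))  ≡⟨ cong sum (map-∘ (allFin n)) ⟨
    sum (map (length ∘ F ∘ (σ ⟨$⟩ʳ_)) (allFin n))      ≡⟨ cong sum (map-cong length-relabel (allFin n)) ⟩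
    edges g                                            ∎
    where
      open ≡-Reasoning
      σ = canonicalLabelling g
      F = relabel σ (out g)
      length-relabel : ∀ v → length (F (σ ⟨$⟩ʳ v)) ≡ length (out g v)
      length-relabel v = trans (length-map (σ ⟨$⟩ʳ_) (out g (σ ⟨$⟩ˡ (σ ⟨$⟩ʳ v))))
                               (cong (length ∘ out g) (inverseˡ σ))

  successors-arcCode : ∀ g v → successors v (arcCode g) ≡ relabel (canonicalLabelling g) (out g) v
  successors-arcCode g v = successors-arcs _ (Unique-map-⟨$⟩ʳ-allFin σ) (∈-map-⟨$⟩ʳ-allFin σ v)
    where σ = canonicalLabelling g

  arcCode-injective : ∀ g h → sources g ≡ sources h → arcCode g ≡ arcCode h → Iso g h
  arcCode-injective g h same-sources same-code =
    Iso-from-relabel g h σ ρ same-out (begin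
      map (σ ⟨$⟩ʳ_) (srcs g)  ≡⟨ proj₂ (canonicalise (srcs g) (srcs-unique g)) ⟩
      canonical (sources g)   ≡⟨ cong canonical same-sources ⟩
      canonical (sources h)   ≡⟨ proj₂ (canonicalise (srcs h) (srcs-unique h)) ⟨
      map (ρ ⟨$⟩ʳ_) (srcs h)  ∎)
    where
      open ≡-Reasoning
      σ = canonicalLabelling g
      ρ = canonicalLabelling h
      same-out : ∀ v → relabel σ (out g) v ≡ relabel ρ (out h) v
      same-out v = begin
        relabel σ (out g) v       ≡⟨ successors-arcCode g v ⟨
        successors v (arcCode g)  ≡⟨ cong (successors v) same-code ⟩
        successors v (arcCode h)  ≡⟨ successors-arcCode h v ⟩
        relabel ρ (out h) v       ∎

combine-uncurried-injective : ∀ {m n} {p q : Fin m × Fin n} →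
                              uncurry combine p ≡ uncurry combine q → p ≡ q
combine-uncurried-injective {p = u , v} {q = u′ , v′} eq
  with refl , refl ← combine-injective u v u′ v′ eq = refl

doagCode : ∀ {n} m → DOAG (suc n) → Fin ((suc n * suc n) ^ m)
doagCode m g = encode m (map (uncurry combine) (arcCode g))

doagCode-injective : ∀ {n m} (g h : DOAG (suc n)) → edges g ≡ m → edges h ≡ m →
                     sources g ≡ sources h → doagCode m g ≡ doagCode m h → Iso g h
doagCode-injective {n} {m} g h g-edges h-edges same-sources same-code =
  arcCode-injective g h same-sources
    (map-injective (combine-uncurried-injective {suc n} {suc n})
      (encode-injective m (length-code g g-edges) (length-code h h-edges) same-code))
  where
    length-code : ∀ g → edges g ≡ m → length (map (uncurry combine) (arcCode g)) ≡ m
    length-code g g-edges =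
      trans (length-map (uncurry combine) (arcCode g)) (trans (length-arcCode g) g-edges)

D≤[n*n]^m : ∀ {n m k D} → IsD (suc n) m k D → D ≤ (suc n * suc n) ^ m
D≤[n*n]^m {n} {m} {k} (L , refl , shapes , non-isomorphic , _) =
  distinct-images⇒length≤ (doagCode m)
    (AllPairs-mapWithAll (λ {g} {h} → codes-differ {g} {h}) shapes non-isomorphic)
  where
    codes-differ : ∀ {g h} → edges g ≡ m × sources g ≡ k → edges h ≡ m × sources h ≡ k →
                   ¬ Iso g h → doagCode m g ≢ doagCode m h
    codes-differ {g} {h} (g-edges , g-sources) (h-edges , h-sources) g≇h =
      g≇h ∘ doagCode-injective g h g-edges h-edges (trans g-sources (sym h-sources))

[n*n]^m≡n^[2*m] : ∀ n m → (n * n) ^ m ≡ n ^ (2 * m)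
[n*n]^m≡n^[2*m] n m = trans (cong (λ x → (n * x) ^ m) (sym (*-identityʳ n))) (^-*-assoc n 2 m)

corollary2p6 : Σ ℕ λ c → 0 < c ×
    ((n m k D : ℕ) → 1 ≤ n → IsD n m k D → 0 < D → D ≤ n ^ (c * m))
corollary2p6 = 2 , s≤s z≤n , λ where
  (suc n) m k D _ isD _ → subst (D ≤_) ([n*n]^m≡n^[2*m] (suc n) m) (D≤[n*n]^m isD)
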